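{- Let $r\ge0$ and $m,n>1$ be integers and let $p>0$ be real. Then \[\sum_{1\le k_m<\cdots<k_1\le n}\frac{1}{(k_1+r)^p\cdots(k_m+r)^p}=\sum_{\substack{i+j=m\\ i,j\ge0}}(-1)^i\,\zeta_r^\star(\{p\}_i)\,\zeta_{n+r}(\{p\}_j),\] and \[\sum_{1\le k_m\le\cdots\le k_1\le n}\frac{1}{(k_1+r)^p\cdots(k_m+r)^p}=\sum_{\substack{i+j=m\\ i,j\ge0}}(-1)^i\,\zeta_r(\{p\}_i)\,\zeta^\star_{n+r}(\{p\}_j).\]
   Context: $\{p\}_q$ denotes $p$ repeated $q$ times. For a positive integer $N$, $\zeta_N(\{p\}_j)=\sum_{N\ge n_1>\cdots>n_j\ge1}\frac{1}{(n_1\cdots n_j)^p}$ and $\zeta_N^\star(\{p\}_i)=\sum_{N\ge n_1\ge\cdots\ge n_i\ge1}\frac{1}{(n_1\cdots n_i)^p}$, with empty-argument values equal to $1$ and $\zeta_N(\{p\}_j)=0$ if $N<j$. For $N=0$: $\zeta_0(\emptyset)=\zeta_0^\star(\emptyset)=1$ and $\zeta_0(\{p\}_j)=\zeta_0^\star(\{p\}_i)=0$ for $i,j\ge1$. -}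

module Defs where

open import Level using (Level)
open import Data.Nat using (ℕ; zero; suc)
open import Algebra.Bundles using (CommutativeRing)

-- Everything is relative to a commutative ring R and a weight sequence
-- u : ℕ → R ; the paper's case is R = ℝ, u k = 1 / k ^ p.
module Zeta {c ℓ : Level} (R : CommutativeRing c ℓ) where
  open CommutativeRing R hiding (zero)

  -- zetaW u N j = Σ_{N ≥ n₁ > ⋯ > n_j ≥ 1} u n₁ ⋯ u n_j
  -- (decomposed according to whether n₁ = N or n₁ < N);
  -- empty argument gives 1, N < j gives 0.
  zetaW : (ℕ → Carrier) → ℕ → ℕ → Carrier
  zetaW u N       zero    = 1#
  zetaW u zero    (suc j) = 0#
  zetaW u (suc N) (suc j) = zetaW u N (suc j) + u (suc N) * zetaW u N j

  -- zetaW⋆ u N i = Σ_{N ≥ n₁ ≥ ⋯ ≥ n_i ≥ 1} u n₁ ⋯ u n_i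
  zetaW⋆ : (ℕ → Carrier) → ℕ → ℕ → Carrier
  zetaW⋆ u N       zero    = 1#
  zetaW⋆ u zero    (suc i) = 0#
  zetaW⋆ u (suc N) (suc i) = zetaW⋆ u N (suc i) + u (suc N) * zetaW⋆ u (suc N) i

  sign : ℕ → Carrier
  sign zero    = 1#
  sign (suc i) = - sign i

  sumUpTo : (ℕ → Carrier) → ℕ → Carrier
  sumUpTo f zero    = f zero
  sumUpTo f (suc m) = sumUpTo f m + f (suc m)

module Submission where

-- Read a sequence f : ℕ → R as the formal power series Σ f k Xᵏ.  Writing
-- e_N = Σ_j zetaW u N j Xʲ and h_N = Σ_i zetaW⋆ u N i Xⁱ, the defining
-- recursions say
--     e_{N+1} = (1 + u_{N+1} X) e_N,        h_N = (1 - u_{N+1} X) h_{N+1},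
-- i.e. e_N = Π_{k ≤ N} (1 + u_k X) and h_N = Π_{k ≤ N} (1 - u_k X)⁻¹.
-- Hence e_r(X) · h_r(-X) = 1 and h_r(X) · e_r(-X) = 1 for every r, and the
-- series of the shifted weights u (k + r), k ≤ n, are
--     Π_{r < k ≤ n + r} (1 + u_k X) = h_r(-X) · e_{n+r}(X),
--     Π_{r < k ≤ n + r} (1 - u_k X)⁻¹ = e_r(-X) · h_{n+r}(X).
-- Comparing coefficients of Xᵐ gives the theorem.

open import Defs
open import Data.Nat using (ℕ; _∸_; _<_) renaming (_+_ to _+ℕ_)
open import Data.Product using (_×_; _,_)
open import Algebra.Bundles using (CommutativeRing)

module GeneratingSeries {c ℓ} (R : CommutativeRing c ℓ) where
  open CommutativeRing R hiding (zero)
  open Zeta R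
  open import Data.Nat using (zero; suc; _≤_; z≤n)
  open import Data.Nat.Properties using (≤-refl; m≤n⇒m≤1+n; +-∸-assoc; n∸n≡0)
  open import Relation.Binary.PropositionalEquality as ≡ using (_≡_)
  open import Algebra.Properties.Ring ring
    using (-‿distribˡ-*; -‿involutive; +-cancelʳ; //-rightDividesʳ)
  open import Algebra.Solver.Ring.NaturalCoefficients.Default commutativeSemiring
    using (solve; _:=_; _:+_; _:*_)
  open import Relation.Binary.Reasoning.Setoid setoid

  sum-congᵇ : ∀ {f g} m → (∀ i → i ≤ m → f i ≈ g i) → sumUpTo f m ≈ sumUpTo g m
  sum-congᵇ zero    e = e zero z≤n
  sum-congᵇ (suc m) e =
    +-cong (sum-congᵇ m (λ i i≤m → e i (m≤n⇒m≤1+n i≤m))) (e (suc m) ≤-refl)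

  sum-cong : ∀ {f g} m → (∀ i → f i ≈ g i) → sumUpTo f m ≈ sumUpTo g m
  sum-cong m e = sum-congᵇ m (λ i _ → e i)

  sum-+ : ∀ f g m → sumUpTo (λ i → f i + g i) m ≈ sumUpTo f m + sumUpTo g m
  sum-+ f g zero    = refl
  sum-+ f g (suc m) = trans (+-congʳ (sum-+ f g m))
    (solve 4 (λ a b x y → (a :+ b) :+ (x :+ y) := (a :+ x) :+ (b :+ y)) refl _ _ _ _)

  sum-*ˡ : ∀ a f m → sumUpTo (λ i → a * f i) m ≈ a * sumUpTo f m
  sum-*ˡ a f zero    = refl
  sum-*ˡ a f (suc m) = trans (+-congʳ (sum-*ˡ a f m)) (sym (distribˡ a _ _))

  sum-first : ∀ h m → sumUpTo h (suc m) ≈ h zero + sumUpTo (λ j → h (suc j)) m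
  sum-first h zero    = refl
  sum-first h (suc m) = trans (+-congʳ (sum-first h m)) (+-assoc _ _ _)

  sum-zero : ∀ f m → (∀ i → f i ≈ 0#) → sumUpTo f m ≈ 0#
  sum-zero f zero    e = e zero
  sum-zero f (suc m) e = trans (+-cong (sum-zero f m e) (e (suc m))) (+-identityˡ 0#)

  Series : Set c
  Series = ℕ → Carrier

  infix 4 _≐_
  _≐_ : Series → Series → Set ℓ
  f ≐ g = ∀ k → f k ≈ g k

  one : Series
  one zero    = 1#
  one (suc _) = 0#

  infixl 7 _⊛_
  _⊛_ : Series → Series → Series
  (f ⊛ g) m = sumUpTo (λ i → f i * g (m ∸ i)) m

  linMul : Carrier → Series → Series
  linMul a f zero    = f zero
  linMul a f (suc k) = f (suc k) + a * f k

  -- The substitution X ↦ -X: f (-X) has coefficients (-1)ⁱ f i.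
  alt : Series → Series
  alt f i = sign i * f i

  ⊛-cong : ∀ {f f′ g g′} → f ≐ f′ → g ≐ g′ → f ⊛ g ≐ f′ ⊛ g′
  ⊛-cong ef eg m = sum-cong m (λ i → *-cong (ef i) (eg (m ∸ i)))

  ⊛-congˡ : ∀ {f f′} g → f ≐ f′ → f ⊛ g ≐ f′ ⊛ g
  ⊛-congˡ g ef = ⊛-cong {g = g} ef (λ _ → refl)

  ⊛-congʳ : ∀ f {g g′} → g ≐ g′ → f ⊛ g ≐ f ⊛ g′
  ⊛-congʳ f eg = ⊛-cong {f = f} (λ _ → refl) eg

  linMul-cong : ∀ {a b f g} → a ≈ b → f ≐ g → linMul a f ≐ linMul b g
  linMul-cong a≈b e zero    = e zero
  linMul-cong a≈b e (suc k) = +-cong (e (suc k)) (*-cong a≈b (e k))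

  -- 1 + aX is cancellable: its constant coefficient is 1.
  linMul-injective : ∀ a {f g} → linMul a f ≐ linMul a g → f ≐ g
  linMul-injective a e zero    = e zero
  linMul-injective a {f} {g} e (suc k) = +-cancelʳ (a * f k) _ _
    (trans (e (suc k)) (+-congˡ (*-congˡ (sym (linMul-injective a e k)))))

  alt-cong : ∀ {f g} → f ≐ g → alt f ≐ alt g
  alt-cong e i = *-congˡ (e i)

  alt-one : alt one ≐ one
  alt-one zero    = *-identityˡ 1#
  alt-one (suc i) = zeroʳ _

  alt-linMul : ∀ a f → alt (linMul a f) ≐ linMul (- a) (alt f)
  alt-linMul a f zero    = refl
  alt-linMul a f (suc k) =
    trans (distribˡ (- sign k) (f (suc k)) (a * f k)) (+-congˡ (neg-swap (sign k) (f k)))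
    where
    neg-swap : ∀ s y → (- s) * (a * y) ≈ (- a) * (s * y)
    neg-swap s y = begin
      (- s) * (a * y)   ≈⟨ sym (-‿distribˡ-* s (a * y)) ⟩
      - (s * (a * y))   ≈⟨ -‿cong (solve 3 (λ a s y → s :* (a :* y) := a :* (s :* y)) refl a s y) ⟩
      - (a * (s * y))   ≈⟨ -‿distribˡ-* a (s * y) ⟩
      (- a) * (s * y)   ∎

  ⊛-identityˡ : ∀ g → one ⊛ g ≐ g
  ⊛-identityˡ g zero    = *-identityˡ (g zero)
  ⊛-identityˡ g (suc m) = begin
    (one ⊛ g) (suc m)
      ≈⟨ sum-first _ m ⟩
    1# * g (suc m) + sumUpTo (λ j → 0# * g (m ∸ j)) m
      ≈⟨ +-cong (*-identityˡ _) (sum-zero _ m (λ j → zeroˡ _)) ⟩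
    g (suc m) + 0#
      ≈⟨ +-identityʳ _ ⟩
    g (suc m) ∎

  ⊛-linMulˡ : ∀ a f g → linMul a f ⊛ g ≐ linMul a (f ⊛ g)
  ⊛-linMulˡ a f g zero    = refl
  ⊛-linMulˡ a f g (suc m) = begin
    (linMul a f ⊛ g) (suc m)
      ≈⟨ sum-first _ m ⟩
    f zero * g (suc m) + sumUpTo (λ j → (f (suc j) + a * f j) * g (m ∸ j)) m
      ≈⟨ +-congˡ (sum-cong m (λ j → expand (f (suc j)) (f j) (g (m ∸ j)))) ⟩
    f zero * g (suc m) + sumUpTo (λ j → f (suc j) * g (m ∸ j) + a * (f j * g (m ∸ j))) m
      ≈⟨ +-congˡ (sum-+ _ _ m) ⟩
    f zero * g (suc m) + (sumUpTo (λ j → f (suc j) * g (m ∸ j)) m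
                          + sumUpTo (λ j → a * (f j * g (m ∸ j))) m)
      ≈⟨ sym (+-assoc _ _ _) ⟩
    (f zero * g (suc m) + sumUpTo (λ j → f (suc j) * g (m ∸ j)) m)
      + sumUpTo (λ j → a * (f j * g (m ∸ j))) m
      ≈⟨ +-cong (sym (sum-first (λ i → f i * g (suc m ∸ i)) m)) (sum-*ˡ a _ m) ⟩
    linMul a (f ⊛ g) (suc m) ∎
    where
    expand : ∀ x y z → (x + a * y) * z ≈ x * z + a * (y * z)
    expand = solve 4 (λ a x y z → (x :+ a :* y) :* z := x :* z :+ a :* (y :* z)) refl a

  ⊛-linMulʳ : ∀ a f g → f ⊛ linMul a g ≐ linMul a (f ⊛ g)
  ⊛-linMulʳ a f g zero    = refl
  ⊛-linMulʳ a f g (suc m) = begin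
    (f ⊛ linMul a g) (suc m)
      ≈⟨ +-cong (sum-congᵇ m (λ i i≤m → *-congˡ (reflexive (inner i i≤m))))
                (*-congˡ (reflexive (≡.cong (linMul a g) (n∸n≡0 m)))) ⟩
    sumUpTo (λ i → f i * (g (suc m ∸ i) + a * g (m ∸ i))) m + f (suc m) * g zero
      ≈⟨ +-congʳ (sum-cong m (λ i → expand (f i) (g (suc m ∸ i)) (g (m ∸ i)))) ⟩
    sumUpTo (λ i → f i * g (suc m ∸ i) + a * (f i * g (m ∸ i))) m + f (suc m) * g zero
      ≈⟨ +-congʳ (trans (sum-+ _ _ m) (+-congˡ (sum-*ˡ a _ m))) ⟩
    (sumUpTo (λ i → f i * g (suc m ∸ i)) m + a * (f ⊛ g) m) + f (suc m) * g zero
      ≈⟨ solve 3 (λ x y z → (x :+ y) :+ z := (x :+ z) :+ y) refl _ _ _ ⟩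
    (sumUpTo (λ i → f i * g (suc m ∸ i)) m + f (suc m) * g zero) + a * (f ⊛ g) m
      ≈⟨ +-congʳ (+-congˡ (*-congˡ (reflexive (≡.cong g (≡.sym (n∸n≡0 m)))))) ⟩
    linMul a (f ⊛ g) (suc m) ∎
    where
    -- For i ≤ m the index m + 1 - i is a successor, so linMul unfolds.
    inner : ∀ i → i ≤ m → linMul a g (suc m ∸ i) ≡ g (suc m ∸ i) + a * g (m ∸ i)
    inner i i≤m rewrite +-∸-assoc 1 i≤m = ≡.refl
    expand : ∀ x y z → x * (y + a * z) ≈ x * y + a * (x * z)
    expand = solve 4 (λ a x y z → x :* (y :+ a :* z) := x :* y :+ a :* (x :* z)) refl a

  ⊛-linMul-transfer : ∀ a f g → linMul a f ⊛ g ≐ f ⊛ linMul a g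
  ⊛-linMul-transfer a f g m = trans (⊛-linMulˡ a f g m) (sym (⊛-linMulʳ a f g m))

  e h : (ℕ → Carrier) → ℕ → Series
  e = zetaW
  h = zetaW⋆

  e-zero : ∀ u → e u 0 ≐ one
  e-zero u zero    = refl
  e-zero u (suc j) = refl

  h-zero : ∀ u → h u 0 ≐ one
  h-zero u zero    = refl
  h-zero u (suc i) = refl

  -- e_{N+1} = (1 + u_{N+1} X) e_N: the largest index is N + 1 or not.
  e-suc : ∀ u N → e u (suc N) ≐ linMul (u (suc N)) (e u N)
  e-suc u N zero    = refl
  e-suc u N (suc j) = refl

  -- h_N = (1 - u_{N+1} X) h_{N+1}: the defining recursion
  -- h_{N+1} = h_N + u_{N+1} X h_{N+1}, solved for h_N.
  h-pred : ∀ u N → h u N ≐ linMul (- u (suc N)) (h u (suc N))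
  h-pred u N zero    = refl
  h-pred u N (suc i) = begin
    h u N (suc i)                        ≈⟨ sym (//-rightDividesʳ (x * y) (h u N (suc i))) ⟩
    (h u N (suc i) + x * y) + - (x * y)  ≈⟨ +-congˡ (-‿distribˡ-* x y) ⟩
    (h u N (suc i) + x * y) + (- x) * y  ∎
    where
    x = u (suc N)
    y = h u (suc N) i

  -- Inversion: e_r(X) h_r(-X) = 1, by induction on r, using that the
  -- factor 1 + u_{r+1} X of e_{r+1} cancels against h_r(-X).
  alt-h⊛e : ∀ u r → alt (h u r) ⊛ e u r ≐ one
  alt-h⊛e u zero m = begin
    (alt (h u 0) ⊛ e u 0) m  ≈⟨ ⊛-cong (λ i → trans (alt-cong (h-zero u) i) (alt-one i)) (e-zero u) m ⟩
    (one ⊛ one) m            ≈⟨ ⊛-identityˡ one m ⟩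
    one m                    ∎
  alt-h⊛e u (suc r) m = begin
    (alt (h u (suc r)) ⊛ e u (suc r)) m                  ≈⟨ ⊛-congʳ _ (e-suc u r) m ⟩
    (alt (h u (suc r)) ⊛ linMul x (e u r)) m             ≈⟨ sym (⊛-linMul-transfer x _ _ m) ⟩
    (linMul x (alt (h u (suc r))) ⊛ e u r) m             ≈⟨ ⊛-congˡ (e u r) step m ⟩
    (alt (h u r) ⊛ e u r) m                              ≈⟨ alt-h⊛e u r m ⟩
    one m                                                ∎
    where
    x = u (suc r)
    step : linMul x (alt (h u (suc r))) ≐ alt (h u r)
    step k = begin
      linMul x (alt (h u (suc r))) k          ≈⟨ linMul-cong (sym (-‿involutive x)) (λ _ → refl) k ⟩
      linMul (- - x) (alt (h u (suc r))) k    ≈⟨ sym (alt-linMul (- x) _ k) ⟩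
      alt (linMul (- x) (h u (suc r))) k      ≈⟨ sym (alt-cong (h-pred u r) k) ⟩
      alt (h u r) k                           ∎

  alt-e⊛h : ∀ u r → alt (e u r) ⊛ h u r ≐ one
  alt-e⊛h u zero m = begin
    (alt (e u 0) ⊛ h u 0) m  ≈⟨ ⊛-cong (λ i → trans (alt-cong (e-zero u) i) (alt-one i)) (h-zero u) m ⟩
    (one ⊛ one) m            ≈⟨ ⊛-identityˡ one m ⟩
    one m                    ∎
  alt-e⊛h u (suc r) m = begin
    (alt (e u (suc r)) ⊛ h u (suc r)) m                    ≈⟨ ⊛-congˡ (h u (suc r)) step m ⟩
    (linMul (- x) (alt (e u r)) ⊛ h u (suc r)) m           ≈⟨ ⊛-linMul-transfer (- x) _ _ m ⟩
    (alt (e u r) ⊛ linMul (- x) (h u (suc r))) m           ≈⟨ ⊛-congʳ _ (λ k → sym (h-pred u r k)) m ⟩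
    (alt (e u r) ⊛ h u r) m                                ≈⟨ alt-e⊛h u r m ⟩
    one m                                                  ∎
    where
    x = u (suc r)
    step : alt (e u (suc r)) ≐ linMul (- x) (alt (e u r))
    step k = trans (alt-cong (e-suc u r) k) (alt-linMul x (e u r) k)

  shift : (ℕ → Carrier) → ℕ → ℕ → Carrier
  shift u r k = u (k +ℕ r)

  e-shift : ∀ u r n → e (shift u r) n ≐ alt (h u r) ⊛ e u (n +ℕ r)
  e-shift u r zero    k = trans (e-zero (shift u r) k) (sym (alt-h⊛e u r k))
  e-shift u r (suc n) k = begin
    e (shift u r) (suc n) k                        ≈⟨ e-suc (shift u r) n k ⟩
    linMul x (e (shift u r) n) k                   ≈⟨ linMul-cong refl (e-shift u r n) k ⟩
    linMul x (alt (h u r) ⊛ e u (n +ℕ r)) k        ≈⟨ sym (⊛-linMulʳ x _ _ k) ⟩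
    (alt (h u r) ⊛ linMul x (e u (n +ℕ r))) k      ≈⟨ ⊛-congʳ _ (λ j → sym (e-suc u (n +ℕ r) j)) k ⟩
    (alt (h u r) ⊛ e u (suc n +ℕ r)) k             ∎
    where x = u (suc n +ℕ r)

  -- Π_{r < k ≤ n + r} (1 - u_k X)⁻¹ = e_r(-X) h_{n+r}(X): both sides become
  -- the previous case after multiplication by 1 - u_{n+r+1} X.
  h-shift : ∀ u r n → h (shift u r) n ≐ alt (e u r) ⊛ h u (n +ℕ r)
  h-shift u r zero    k = trans (h-zero (shift u r) k) (sym (alt-e⊛h u r k))
  h-shift u r (suc n) = linMul-injective (- x) λ k → begin
    linMul (- x) (h (shift u r) (suc n)) k                  ≈⟨ sym (h-pred (shift u r) n k) ⟩
    h (shift u r) n k                                       ≈⟨ h-shift u r n k ⟩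
    (alt (e u r) ⊛ h u (n +ℕ r)) k                          ≈⟨ ⊛-congʳ _ (h-pred u (n +ℕ r)) k ⟩
    (alt (e u r) ⊛ linMul (- x) (h u (suc n +ℕ r))) k       ≈⟨ ⊛-linMulʳ (- x) _ _ k ⟩
    linMul (- x) (alt (e u r) ⊛ h u (suc n +ℕ r)) k         ∎
    where x = u (suc n +ℕ r)

theorem2p7 : ∀ {c ℓ} (R : CommutativeRing c ℓ) (u : ℕ → CommutativeRing.Carrier R)
    (r m n : ℕ) → 1 < m → 1 < n →
    let open CommutativeRing R
        open Zeta R
    in (zetaW (λ k → u (k +ℕ r)) n m
          ≈ sumUpTo (λ i → sign i * zetaW⋆ u r i * zetaW u (n +ℕ r) (m ∸ i)) m)
       × (zetaW⋆ (λ k → u (k +ℕ r)) n m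
          ≈ sumUpTo (λ i → sign i * zetaW u r i * zetaW⋆ u (n +ℕ r) (m ∸ i)) m)
theorem2p7 R u r m n _ _ = e-shift u r n m , h-shift u r n m
  where open GeneratingSeries R
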